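{- Let $\mathcal{D}=\{(\Sigma_k,L_k,G_k)\}_{k\in\mathbb{N}}$ be a treelike decomposition class and $C$ a $\mathcal{D}$-coherent treelike DP-core. Then for each $k\in\mathbb{N}$, $P(\mathcal{D}_k)\subseteq P(C,\mathcal{D})$ if and only if $L_k\subseteq \mathrm{Acc}(C[k])$, where $\mathrm{Acc}(C[k])$ is the set of terms accepted by $C[k]$.
   Context: Graphs: triples $G=(V,E,I)$, $V,E$ finite subsets of $\mathbb{N}$, $I\subseteq E\times V$; $\simeq$ isomorphism; isomorphism closure of a set of graphs = all graphs isomorphic to one of its members. Terms over a ranked alphabet: finite rooted ordered labelled trees (arity = number of children). Treelike decomposition class: $\mathcal{D}=\{(\Sigma_k,L_k,G_k)\}_{k}$, $\Sigma_k$ ranked alphabet, $L_k$ regular tree language over $\Sigma_k$, $G_k:L_k\to$ graphs, $\Sigma_k\subseteq\Sigma_{k+1}$, $L_k\subseteq L_{k+1}$, $G_{k+1}|_{L_k}=G_k$; $G(\tau)=G_k(\tau)$; $P(\mathcal{D}_k)$ = isomorphism closure of $\{G(\tau):\tau\in L_k\}$. Treelike DP-core $C=\{C[k]\}$, $C[k]=(\Sigma_k,W_k,F_k,T_k,\mathrm{Clean}_k,\mathrm{Inv}_k)$: $W_k\subseteq\{0,1\}^*$ decidable; $F_k:W_k\to\{0,1\}$ ($w$ final iff $F_k(w)=1$); finite $\hat a\subseteq W_k$ for arity-$0$ $a$; $\hat a:W_k^p\to$ finite subsets of $W_k$ for arity $p\ge1$; $\mathrm{Clean}_k$, $\mathrm{Inv}_k$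 map finite subsets of $W_k$ to finite subsets of $W_k$, resp. $\{0,1\}^*$. $\hat a(S_1,\dots,S_p)=\mathrm{Clean}_k(\bigcup_{w_i\in S_i}\hat a(w_1,\dots,w_p))$; $\mathrm{Dyn}_k(a)=\hat a$ (arity 0), $\mathrm{Dyn}_k(a(\tau_1,\dots,\tau_p))=\hat a(\mathrm{Dyn}_k(\tau_1),\dots,\mathrm{Dyn}_k(\tau_p))$; a term $\tau$ over $\Sigma_k$ is accepted by $C[k]$ iff $\mathrm{Dyn}_k(\tau)$ contains a final witness. $P(C,\mathcal{D})=\bigcup_k$ (isomorphism closure of $\{G(\tau):\tau\in L_k$ accepted by $C[k]\}$). $C$ is $\mathcal{D}$-coherent if the alphabet of $C[k]$ is $\Sigma_k$ for all $k$ and for all $\tau\in L_k,\tau'\in L_{k'}$ with $G(\tau)\simeq G(\tau')$: $\tau$ accepted by $C[k]$ iff $\tau'$ accepted by $C[k']$, and $\mathrm{Inv}_k(\mathrm{Dyn}_k(\tau))=\mathrm{Inv}_{k'}(\mathrm{Dyn}_{k'}(\tau'))$. -}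

module Defs where

open import Data.Nat using (ℕ; zero; suc; _<_)
open import Data.Bool using (Bool; true; false; T; _∧_)
open import Data.Fin using (Fin)
open import Data.List using (List; []; _∷_; _++_; concatMap; map)
open import Data.List.Membership.Propositional using (_∈_)
open import Data.List.Relation.Unary.Any using (Any)
open import Data.Vec using (Vec; []; _∷_)
open import Data.Product using (Σ; ∃; ∃-syntax; _×_; _,_; proj₁)
open import Function.Bundles using (_↔_; _⇔_; Inverse)
open import Relation.Binary.PropositionalEquality using (_≡_)

-- Graphs  G = (V, E, I),  V, E finite subsets of ℕ,  I ⊆ E × V.
-- Finite subsets of ℕ are given by their (decidable) characteristic
-- functions together with a bound witnessing finiteness.

record Graph : Set where
  field
    V   : ℕ → Bool
    E   : ℕ → Bool
    I   : ℕ → ℕ → Bool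
    I⊆  : ∀ e v → T (I e v) → T (E e) × T (V v)
    finV : ∃[ n ] (∀ v → T (V v) → v < n)
    finE : ∃[ n ] (∀ e → T (E e) → e < n)

Vert : Graph → Set
Vert G = Σ ℕ (λ v → T (Graph.V G v))

Edge : Graph → Set
Edge G = Σ ℕ (λ e → T (Graph.E G e))

_≡G_ : Graph → Graph → Set
G ≡G H = (∀ v → Graph.V G v ≡ Graph.V H v)
       × (∀ e → Graph.E G e ≡ Graph.E H e)
       × (∀ e v → Graph.I G e v ≡ Graph.I H e v)

record _≃_ (G H : Graph) : Set where
  field
    fV : Vert G ↔ Vert H
    fE : Edge G ↔ Edge H
    preserves : ∀ (e : Edge G) (v : Vert G) →
      T (Graph.I G (proj₁ e) (proj₁ v))
        ⇔ T (Graph.I H (proj₁ (Inverse.to fE e)) (proj₁ (Inverse.to fV v)))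

-- Terms over an ambient ranked set of symbols (A, ar).  A ranked
-- alphabet is a finite subset of A (given by a Bool predicate).

data Term (A : Set) (ar : A → ℕ) : Set where
  node : (a : A) → Vec (Term A ar) (ar a) → Term A ar

mutual
  over : ∀ {A ar} → (A → Bool) → Term A ar → Bool
  over Σ' (node a ts) = Σ' a ∧ overVec Σ' ts

  overVec : ∀ {A ar n} → (A → Bool) → Vec (Term A ar) n → Bool
  overVec Σ' []       = true
  overVec Σ' (t ∷ ts) = over Σ' t ∧ overVec Σ' ts

FiniteAlphabet : {A : Set} → (A → Bool) → Set
FiniteAlphabet {A} Σ' = ∃[ xs ] (∀ (a : A) → T (Σ' a) → a ∈ xs)

record DFTA (A : Set) (ar : A → ℕ) : Set where
  field
    nst   : ℕ
    δ     : (a : A) → Vec (Fin nst) (ar a) → Fin nst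
    final : Fin nst → Bool

  mutual
    run : Term A ar → Fin nst
    run (node a ts) = δ a (runVec ts)

    runVec : ∀ {n} → Vec (Term A ar) n → Vec (Fin nst) n
    runVec []       = []
    runVec (t ∷ ts) = run t ∷ runVec ts

IsRegular : ∀ {A ar} → (A → Bool) → (Term A ar → Bool) → Set
IsRegular {A} {ar} Σ' L =
  ∃[ M ] (∀ (t : Term A ar) → L t ≡ (over Σ' t ∧ DFTA.final M (DFTA.run M t)))

record TDC (A : Set) (ar : A → ℕ) : Set where
  field
    Sig     : ℕ → A → Bool
    Sig-fin : ∀ k → FiniteAlphabet (Sig k)
    L       : ℕ → Term A ar → Bool
    L-reg   : ∀ k → IsRegular (Sig k) (L k)
    Gr      : (k : ℕ) (t : Term A ar) → T (L k t) → Graph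
    Sig-mono : ∀ k a → T (Sig k a) → T (Sig (suc k) a)
    L-mono   : ∀ k t → T (L k t) → T (L (suc k) t)
    Gr-compat : ∀ k t (p : T (L k t)) → Gr (suc k) t (L-mono k t p) ≡G Gr k t p

PDk : ∀ {A ar} → TDC A ar → ℕ → Graph → Set
PDk {A} {ar} D k H = ∃[ t ] Σ (T (TDC.L D k t)) (λ p → TDC.Gr D k t p ≃ H)

-- Treelike DP-cores.  Finite sets are represented by lists, compared
-- up to having the same members.

_~_ : ∀ {X : Set} → List X → List X → Set
xs ~ ys = ∀ x → (x ∈ xs) ⇔ (x ∈ ys)

Word : Set
Word = List Bool

tuples : ∀ {X : Set} {p} → Vec (List X) p → List (Vec X p)
tuples []       = [] ∷ []
tuples (S ∷ Ss) = concatMap (λ w → map (w ∷_) (tuples Ss)) S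

record DPCoreLevel (A : Set) (ar : A → ℕ) : Set₁ where
  field
    alph    : A → Bool
    alph-fin : FiniteAlphabet alph
    W       : Word → Bool
  Wit : Set
  Wit = Σ Word (λ w → T (W w))
  field
    F       : Wit → Bool
    -- â : for arity 0 a finite set of witnesses (the case of the empty tuple),
    --     for arity p ≥ 1 a map W^p → finite subsets of W
    hat     : (a : A) → Vec Wit (ar a) → List Wit
    Clean   : List Wit → List Wit
    Inv     : List Wit → List Word
    -- Clean and Inv are functions on finite sets
    Clean-resp : ∀ {S S'} → S ~ S' → Clean S ~ Clean S'
    Inv-resp   : ∀ {S S'} → S ~ S' → Inv S ~ Inv S'

  combine : (p : ℕ) → (Vec Wit p → List Wit) → Vec (List Wit) p → List Wit
  combine zero    h Ss = h []
  combine (suc p) h Ss = Clean (concatMap h (tuples Ss))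

  mutual
    Dyn : Term A ar → List Wit
    Dyn (node a ts) = combine (ar a) (hat a) (DynVec ts)

    DynVec : ∀ {n} → Vec (Term A ar) n → Vec (List Wit) n
    DynVec []       = []
    DynVec (t ∷ ts) = Dyn t ∷ DynVec ts

  Accepted : Term A ar → Set
  Accepted t = T (over alph t) × Any (λ w → T (F w)) (Dyn t)

DPCore : (A : Set) → (A → ℕ) → Set₁
DPCore A ar = ℕ → DPCoreLevel A ar

Acc : ∀ {A ar} → DPCore A ar → ℕ → Term A ar → Set
Acc C k t = DPCoreLevel.Accepted (C k) t

PCD : ∀ {A ar} → DPCore A ar → TDC A ar → Graph → Set
PCD {A} {ar} C D H =
  ∃[ k ] ∃[ t ] Σ (T (TDC.L D k t)) (λ p → Acc C k t × (TDC.Gr D k t p ≃ H))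

Coherent : ∀ {A ar} → TDC A ar → DPCore A ar → Set
Coherent {A} {ar} D C =
    (∀ k a → DPCoreLevel.alph (C k) a ≡ TDC.Sig D k a)
  × (∀ k k' (t t' : Term A ar) (p : T (TDC.L D k t)) (p' : T (TDC.L D k' t')) →
       TDC.Gr D k t p ≃ TDC.Gr D k' t' p' →
         (Acc C k t ⇔ Acc C k' t')
       × (DPCoreLevel.Inv (C k) (DPCoreLevel.Dyn (C k) t)
            ~ DPCoreLevel.Inv (C k') (DPCoreLevel.Dyn (C k') t')))

{-# OPTIONS --safe #-}
module Submission where

open import Defs
open import Data.Nat using (ℕ)
open import Data.Bool using (T)
open import Data.Product using (_,_; proj₁; proj₂)
open import Function.Bundles using (_⇔_; mk⇔; Equivalence)
open import Function.Construct.Identity using (↔-id; ⇔-id)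

-- If every τ ∈ L_k is accepted, each graph of P(D_k) is isomorphic to an
-- accepted G(τ). Conversely, G(τ) ∈ P(C,D) is witnessed by some τ' ∈ L_k'
-- accepted by C[k'] with G(τ') ≃ G(τ), and coherence transfers acceptance
-- from τ' back to τ.

≃-refl : (G : Graph) → G ≃ G
≃-refl G = record { fV = ↔-id _ ; fE = ↔-id _ ; preserves = λ _ _ → ⇔-id _ }

PDk⊆PCD : ∀ {A ar} (D : TDC A ar) (C : DPCore A ar) (k : ℕ) →
  (∀ t → T (TDC.L D k t) → Acc C k t) →
  ∀ H → PDk D k H → PCD C D H
PDk⊆PCD D C k accepts H (t , t∈L , G≃H) = k , t , t∈L , accepts t t∈L , G≃H

PCD-accepted : ∀ {A ar} (D : TDC A ar) (C : DPCore A ar) → Coherent D C →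
  ∀ k t (t∈L : T (TDC.L D k t)) → PCD C D (TDC.Gr D k t t∈L) → Acc C k t
PCD-accepted D C coh k t t∈L (k' , t' , t'∈L , t'-acc , G'≃G) =
  Equivalence.to (proj₁ (proj₂ coh k' k t' t t'∈L t∈L G'≃G)) t'-acc

lemma3 : (A : Set) (ar : A → ℕ) (D : TDC A ar) (C : DPCore A ar) →
    Coherent D C → (k : ℕ) →
      ((∀ (H : Graph) → PDk D k H → PCD C D H)
        ⇔ (∀ (t : Term A ar) → T (TDC.L D k t) → Acc C k t))
lemma3 A ar D C coh k = mk⇔
  (λ P⊆ t t∈L → PCD-accepted D C coh k t t∈L (P⊆ _ (t , t∈L , ≃-refl _)))
  (PDk⊆PCD D C k)
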